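{- Let $k$ be an odd positive integer and let $F_k:\mathbb{N}\to\mathbb{N}$ be given by $F_k(n)=\frac{3n+k}{2}$ if $n$ is odd and $F_k(n)=\frac{n}{2}$ if $n$ is even. Let $s\ge1$ and let $u_1,d_1,\dots,u_s,d_s$ be positive integers. Let $T_0$ be a positive integer whose trajectory $x_0=T_0$, $x_{t+1}=F_k(x_t)$, follows the orb sequence $(u_1,d_1,\dots,u_s,d_s)$, i.e. among $x_0,x_1,\dots,x_{U+D-1}$ the first $u_1$ are odd, the next $d_1$ are even, the next $u_2$ are odd, the next $d_2$ are even, and so on, ending with $d_s$ even values. Then $$F_k^{U+D}(T_0)=\frac{3^{U}T_0+k\alpha}{2^{U+D}},$$ where $U=\sum_{i=1}^s u_i$, $D=\sum_{i=1}^s d_i$ and $$\alpha=\sum_{i=1}^{s} 2^{\sum_{j=1}^{i-1}(u_j+d_j)}\,(3^{u_i}-2^{u_i})\,3^{\sum_{j=i+1}^{s}u_j}$$ (empty sums are $0$).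
   Context: $F_k^j$ denotes the $j$-fold iterate of $F_k$. An "orb" is a maximal block of consecutive odd iterates (an up iteration, of length $u_i$) followed by a block of consecutive even iterates (a down iteration, of length $d_i$). -}

module Defs where

open import Data.Nat using (ℕ; zero; suc; _+_; _*_; _^_; _/_; _%_)
open import Data.Bool using (Bool; true; false)
open import Data.List using (List; []; _∷_; replicate; _++_; concatMap; map)
open import Data.Nat.ListAction using (sum)
open import Data.Nat using (NonZero)
open import Data.Nat.Properties using (m^n≢0)
open import Data.Product using (_×_; _,_; proj₁; proj₂)
open import Data.Unit using (⊤)
open import Relation.Binary.PropositionalEquality using (_≡_)

Odd : ℕ → Set
Odd n = n % 2 ≡ 1

Even : ℕ → Set
Even n = n % 2 ≡ 0

-- F_k(n) = (3n+k)/2 if n odd, n/2 if n even (floor division; exact when k odd)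
F : ℕ → ℕ → ℕ
F k n with n % 2
... | 0 = n / 2
... | _ = (3 * n + k) / 2

iter : (ℕ → ℕ) → ℕ → ℕ → ℕ
iter f zero    x = x
iter f (suc j) x = iter f j (f x)

-- orb sequence (u₁,d₁,…,u_s,d_s) as list of pairs (uᵢ , dᵢ)
-- parity pattern: true = odd, false = even
pattern-of : List (ℕ × ℕ) → List Bool
pattern-of = concatMap (λ p → replicate (proj₁ p) true ++ replicate (proj₂ p) false)

FollowsPattern : ℕ → List Bool → ℕ → Set
FollowsPattern k []           x = ⊤
FollowsPattern k (true ∷ bs)  x = Odd x  × FollowsPattern k bs (F k x)
FollowsPattern k (false ∷ bs) x = Even x × FollowsPattern k bs (F k x)

FollowsOrbs : ℕ → List (ℕ × ℕ) → ℕ → Set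
FollowsOrbs k orbs x = FollowsPattern k (pattern-of orbs) x

U : List (ℕ × ℕ) → ℕ
U orbs = sum (map proj₁ orbs)

D : List (ℕ × ℕ) → ℕ
D orbs = sum (map proj₂ orbs)

-- α = Σ_i 2^{Σ_{j<i}(u_j+d_j)} (3^{u_i} − 2^{u_i}) 3^{Σ_{j>i} u_j}
-- computed with accumulated exponent e = Σ_{j<i}(u_j+d_j);
-- 3^{u_i} − 2^{u_i} written via truncated subtraction (always ≥ 0 anyway).
open import Data.Nat using (_∸_)

alphaFrom : ℕ → List (ℕ × ℕ) → ℕ
alphaFrom e []               = 0
alphaFrom e ((u , d) ∷ rest) =
  2 ^ e * (3 ^ u ∸ 2 ^ u) * 3 ^ U rest + alphaFrom (e + (u + d)) rest

alpha : List (ℕ × ℕ) → ℕ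
alpha = alphaFrom 0

-- Under F_k an even step halves x, and an odd step satisfies F_k(x) + k = 3(x + k)/2,
-- so a run of u odd steps multiplies x + k by (3/2)^u and a run of d even steps divides
-- by 2^d. Hence 2^(u+d) F_k^(u+d)(x) = 3^u x + k(3^u - 2^u) across one orb, and chaining
-- these affine maps over the orbs, 2^(U+D) F_k^(U+D)(T₀) = 3^U T₀ + k α: each orb
-- contributes its constant 3^u - 2^u, scaled by 2 to the length of the earlier orbs and
-- by 3 to the number of later odd steps.
module Submission where

open import Defs
open import Data.Bool using (Bool; true; false)
open import Data.List using (List; []; _∷_; replicate; _++_; length)
open import Data.List.Properties using (++-assoc; length-replicate)
open import Data.List.Relation.Unary.All using (All)
open import Data.Nat using (ℕ; zero; suc; _+_; _*_; _^_; _∸_; _/_; _%_; _≤_; _<_)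
open import Data.Nat.DivMod using (m≡m%n+[m/n]*n; m*[n/m]≡n; m*n/n≡m)
open import Data.Nat.Divisibility using (_∣_; divides; m%n≡0⇒n∣m)
open import Data.Nat.Properties
open import Data.Nat.Tactic.RingSolver using (solve-∀)
open import Algebra.Properties.CommutativeSemigroup *-commutativeSemigroup using (x∙yz≈y∙xz)
open import Data.Product using (_×_; _,_; proj₁; proj₂)
open import Relation.Binary.PropositionalEquality
open ≡-Reasoning

odd⇒≡1+2*half : ∀ x → Odd x → x ≡ 1 + 2 * (x / 2)
odd⇒≡1+2*half x ox = begin
  x                     ≡⟨ m≡m%n+[m/n]*n x 2 ⟩
  x % 2 + (x / 2) * 2   ≡⟨ cong₂ _+_ ox (*-comm (x / 2) 2) ⟩
  1 + 2 * (x / 2)       ∎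

odd∧odd⇒2∣3*x+k : ∀ k x → Odd k → Odd x → 2 ∣ 3 * x + k
odd∧odd⇒2∣3*x+k k x ok ox = divides (3 * a + b + 2) (begin
  3 * x + k                            ≡⟨ cong₂ (λ y l → 3 * y + l) (odd⇒≡1+2*half x ox) (odd⇒≡1+2*half k ok) ⟩
  3 * (1 + 2 * a) + (1 + 2 * b)        ≡⟨ regroup a b ⟩
  (3 * a + b + 2) * 2                  ∎)
  where
  a = x / 2
  b = k / 2
  regroup : ∀ a b → 3 * (1 + 2 * a) + (1 + 2 * b) ≡ (3 * a + b + 2) * 2
  regroup = solve-∀

F-even : ∀ {k} x → Even x → 2 * F k x ≡ x
F-even x ex rewrite ex = m*[n/m]≡n (m%n≡0⇒n∣m x 2 ex)

F-odd : ∀ {k} x → Odd k → Odd x → 2 * F k x ≡ 3 * x + k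
F-odd x ok ox rewrite ox = m*[n/m]≡n (odd∧odd⇒2∣3*x+k _ x ok ox)

F-odd-shifted : ∀ {k} x → Odd k → Odd x → 2 * (F k x + k) ≡ 3 * (x + k)
F-odd-shifted {k} x ok ox = begin
  2 * (F k x + k)    ≡⟨ *-distribˡ-+ 2 (F k x) k ⟩
  2 * F k x + 2 * k  ≡⟨ cong (_+ 2 * k) (F-odd x ok ox) ⟩
  3 * x + k + 2 * k  ≡⟨ regroup x k ⟩
  3 * (x + k)        ∎
  where
  regroup : ∀ x k → 3 * x + k + 2 * k ≡ 3 * (x + k)
  regroup = solve-∀

iter-+ : ∀ (f : ℕ → ℕ) m n x → iter f (m + n) x ≡ iter f n (iter f m x)
iter-+ f zero    n x = refl
iter-+ f (suc m) n x = iter-+ f m n (f x)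

FollowsPattern-++ : ∀ k bs cs x → FollowsPattern k (bs ++ cs) x →
                    FollowsPattern k bs x × FollowsPattern k cs (iter (F k) (length bs) x)
FollowsPattern-++ k []           cs x p        = _ , p
FollowsPattern-++ k (true  ∷ bs) cs x (o , p)  =
  let q , r = FollowsPattern-++ k bs cs (F k x) p in (o , q) , r
FollowsPattern-++ k (false ∷ bs) cs x (e , p)  =
  let q , r = FollowsPattern-++ k bs cs (F k x) p in (e , q) , r

FollowsPattern-replicate-++ : ∀ k n b cs x → FollowsPattern k (replicate n b ++ cs) x →
                              FollowsPattern k (replicate n b) x × FollowsPattern k cs (iter (F k) n x)
FollowsPattern-replicate-++ k n b cs x p
  with FollowsPattern-++ k (replicate n b) cs x p
... | q , r rewrite length-replicate n {b} = q , r

even-run : ∀ k d x → FollowsPattern k (replicate d false) x → 2 ^ d * iter (F k) d x ≡ x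
even-run k zero    x _        = +-identityʳ x
even-run k (suc d) x (ex , p) = begin
  2 * 2 ^ d * iter (F k) d (F k x)    ≡⟨ *-assoc 2 (2 ^ d) _ ⟩
  2 * (2 ^ d * iter (F k) d (F k x))  ≡⟨ cong (2 *_) (even-run k d (F k x) p) ⟩
  2 * F k x                           ≡⟨ F-even x ex ⟩
  x                                   ∎

odd-run : ∀ {k} → Odd k → ∀ u x → FollowsPattern k (replicate u true) x →
          2 ^ u * (iter (F k) u x + k) ≡ 3 ^ u * (x + k)
odd-run {k} ok zero    x _        = trans (*-identityˡ _) (sym (*-identityˡ _))
odd-run {k} ok (suc u) x (ox , p) = begin
  2 * 2 ^ u * (y + k)         ≡⟨ *-assoc 2 (2 ^ u) (y + k) ⟩
  2 * (2 ^ u * (y + k))       ≡⟨ cong (2 *_) (odd-run ok u (F k x) p) ⟩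
  2 * (3 ^ u * (F k x + k))   ≡⟨ x∙yz≈y∙xz 2 (3 ^ u) (F k x + k) ⟩
  3 ^ u * (2 * (F k x + k))   ≡⟨ cong (3 ^ u *_) (F-odd-shifted x ok ox) ⟩
  3 ^ u * (3 * (x + k))       ≡⟨ x∙yz≈y∙xz (3 ^ u) 3 (x + k) ⟩
  3 * (3 ^ u * (x + k))       ≡⟨ *-assoc 3 (3 ^ u) (x + k) ⟨
  3 * 3 ^ u * (x + k)         ∎
  where
  y = iter (F k) u (F k x)

2^n≤3^n : ∀ n → 2 ^ n ≤ 3 ^ n
2^n≤3^n n = ^-monoˡ-≤ n (n≤1+n 2)

orb-step : ∀ {k} → Odd k → ∀ u d x →
           FollowsPattern k (replicate u true) x →
           FollowsPattern k (replicate d false) (iter (F k) u x) →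
           2 ^ (u + d) * iter (F k) d (iter (F k) u x) ≡ 3 ^ u * x + k * (3 ^ u ∸ 2 ^ u)
-- Adding 2^u k to both sides turns the claim into odd-run, free of truncated subtraction.
orb-step {k} ok u d x pu pd = +-cancelʳ-≡ _ _ _ (begin
  2 ^ (u + d) * w + 2 ^ u * k                   ≡⟨ cong (λ m → m * w + 2 ^ u * k) (^-distribˡ-+-* 2 u d) ⟩
  2 ^ u * 2 ^ d * w + 2 ^ u * k                 ≡⟨ cong (λ m → m + 2 ^ u * k) (*-assoc (2 ^ u) (2 ^ d) w) ⟩
  2 ^ u * (2 ^ d * w) + 2 ^ u * k               ≡⟨ cong (λ m → 2 ^ u * m + 2 ^ u * k) (even-run k d z pd) ⟩
  2 ^ u * z + 2 ^ u * k                         ≡⟨ sym (*-distribˡ-+ (2 ^ u) z k) ⟩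
  2 ^ u * (z + k)                               ≡⟨ odd-run ok u x pu ⟩
  3 ^ u * (x + k)                               ≡⟨ *-distribˡ-+ (3 ^ u) x k ⟩
  3 ^ u * x + 3 ^ u * k                         ≡⟨ cong (λ m → 3 ^ u * x + m * k) (sym (m∸n+n≡m (2^n≤3^n u))) ⟩
  3 ^ u * x + (3 ^ u ∸ 2 ^ u + 2 ^ u) * k       ≡⟨ regroup (3 ^ u * x) (3 ^ u ∸ 2 ^ u) (2 ^ u) k ⟩
  3 ^ u * x + k * (3 ^ u ∸ 2 ^ u) + 2 ^ u * k   ∎)
  where
  z = iter (F k) u x
  w = iter (F k) d z
  regroup : ∀ a c b k → a + (c + b) * k ≡ a + k * c + b * k
  regroup = solve-∀

alphaFrom-scale : ∀ e orbs → alphaFrom e orbs ≡ 2 ^ e * alpha orbs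
alphaFrom-scale e []            = sym (*-zeroʳ (2 ^ e))
alphaFrom-scale e ((u , d) ∷ r) = begin
  2 ^ e * c * 3 ^ U r + alphaFrom (e + (u + d)) r      ≡⟨ cong (2 ^ e * c * 3 ^ U r +_) (alphaFrom-scale (e + (u + d)) r) ⟩
  2 ^ e * c * 3 ^ U r + 2 ^ (e + (u + d)) * alpha r    ≡⟨ cong (λ m → 2 ^ e * c * 3 ^ U r + m * alpha r) (^-distribˡ-+-* 2 e (u + d)) ⟩
  2 ^ e * c * 3 ^ U r + 2 ^ e * 2 ^ (u + d) * alpha r  ≡⟨ factor (2 ^ e) c (3 ^ U r) (2 ^ (u + d)) (alpha r) ⟩
  2 ^ e * (1 * c * 3 ^ U r + 2 ^ (u + d) * alpha r)    ≡⟨ cong (λ m → 2 ^ e * (1 * c * 3 ^ U r + m)) (alphaFrom-scale (u + d) r) ⟨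
  2 ^ e * (1 * c * 3 ^ U r + alphaFrom (u + d) r)      ∎
  where
  c = 3 ^ u ∸ 2 ^ u
  factor : ∀ E c V P a → E * c * V + E * P * a ≡ E * (1 * c * V + P * a)
  factor = solve-∀

alpha-∷ : ∀ u d r → alpha ((u , d) ∷ r) ≡ (3 ^ u ∸ 2 ^ u) * 3 ^ U r + 2 ^ (u + d) * alpha r
alpha-∷ u d r = cong₂ _+_ (cong (_* 3 ^ U r) (*-identityˡ (3 ^ u ∸ 2 ^ u))) (alphaFrom-scale (u + d) r)

FollowsOrbs-∷ : ∀ k u d r x → FollowsOrbs k ((u , d) ∷ r) x →
                FollowsPattern k (replicate u true) x
                × FollowsPattern k (replicate d false) (iter (F k) u x)
                × FollowsOrbs k r (iter (F k) d (iter (F k) u x))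
FollowsOrbs-∷ k u d r x fo =
  let pu , fo′ = FollowsPattern-replicate-++ k u true _ x
                   (subst (λ bs → FollowsPattern k bs x) (++-assoc (replicate u true) _ _) fo)
      pd , pr  = FollowsPattern-replicate-++ k d false _ _ fo′
  in pu , pd , pr

orbs-formula : ∀ {k} → Odd k → ∀ orbs x → FollowsOrbs k orbs x →
               2 ^ (U orbs + D orbs) * iter (F k) (U orbs + D orbs) x ≡ 3 ^ U orbs * x + k * alpha orbs
orbs-formula {k} ok []            x _  = sym (trans (cong (1 * x +_) (*-zeroʳ k)) (+-identityʳ (1 * x)))
orbs-formula {k} ok ((u , d) ∷ r) x fo with FollowsOrbs-∷ k u d r x fo
... | pu , pd , pr = begin
  2 ^ N * iter (F k) N x                           ≡⟨ cong (λ n → 2 ^ n * iter (F k) n x) N≡ ⟩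
  2 ^ (u + d + M) * iter (F k) (u + d + M) x       ≡⟨ cong₂ _*_ (^-distribˡ-+-* 2 (u + d) M) (iter-+ (F k) (u + d) M x) ⟩
  2 ^ (u + d) * 2 ^ M * iter (F k) M y′            ≡⟨ cong (λ m → 2 ^ (u + d) * 2 ^ M * iter (F k) M m) (iter-+ (F k) u d x) ⟩
  2 ^ (u + d) * 2 ^ M * iter (F k) M y             ≡⟨ *-assoc (2 ^ (u + d)) (2 ^ M) _ ⟩
  2 ^ (u + d) * (2 ^ M * iter (F k) M y)           ≡⟨ cong (2 ^ (u + d) *_) (orbs-formula ok r y pr) ⟩
  2 ^ (u + d) * (3 ^ U r * y + k * alpha r)        ≡⟨ distrib (2 ^ (u + d)) (3 ^ U r) y k (alpha r) ⟩
  3 ^ U r * (2 ^ (u + d) * y) + k * (2 ^ (u + d) * alpha r)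
    ≡⟨ cong (λ m → 3 ^ U r * m + k * (2 ^ (u + d) * alpha r)) (orb-step ok u d x pu pd) ⟩
  3 ^ U r * (3 ^ u * x + k * c) + k * (2 ^ (u + d) * alpha r)
    ≡⟨ regroup (3 ^ U r) (3 ^ u) x k c (2 ^ (u + d)) (alpha r) ⟩
  3 ^ u * 3 ^ U r * x + k * (c * 3 ^ U r + 2 ^ (u + d) * alpha r)
    ≡⟨ cong₂ (λ m a → m * x + k * a) (^-distribˡ-+-* 3 u (U r)) (alpha-∷ u d r) ⟨
  3 ^ (u + U r) * x + k * alpha ((u , d) ∷ r)      ∎
  where
  N = U ((u , d) ∷ r) + D ((u , d) ∷ r)
  M = U r + D r
  c = 3 ^ u ∸ 2 ^ u
  y′ = iter (F k) (u + d) x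
  y  = iter (F k) d (iter (F k) u x)
  +-assoc-swap : ∀ u d a b → (u + a) + (d + b) ≡ u + d + (a + b)
  +-assoc-swap = solve-∀
  N≡ : N ≡ u + d + M
  N≡ = +-assoc-swap u d (U r) (D r)
  distrib : ∀ P Q y k a → P * (Q * y + k * a) ≡ Q * (P * y) + k * (P * a)
  distrib = solve-∀
  regroup : ∀ Q T x k c P a → Q * (T * x + k * c) + k * (P * a) ≡ T * Q * x + k * (c * Q + P * a)
  regroup = solve-∀

theorem3 : (k : ℕ) → Odd k → (orbs : List (ℕ × ℕ)) → orbs ≢ [] →
    All (λ p → 0 < proj₁ p × 0 < proj₂ p) orbs →
    (T₀ : ℕ) → 0 < T₀ → FollowsOrbs k orbs T₀ →
    (2 ^ (U orbs + D orbs) ∣ 3 ^ U orbs * T₀ + k * alpha orbs)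
    × (iter (F k) (U orbs + D orbs) T₀
    ≡ _/_ (3 ^ U orbs * T₀ + k * alpha orbs) (2 ^ (U orbs + D orbs))
    ⦃ m^n≢0 2 (U orbs + D orbs) ⦄)
theorem3 k ok orbs _ _ T₀ _ fo = divides I S≡I*2^N , sym S/2^N≡I
  where
  N = U orbs + D orbs
  I = iter (F k) N T₀
  S = 3 ^ U orbs * T₀ + k * alpha orbs
  S≡I*2^N : S ≡ I * 2 ^ N
  S≡I*2^N = trans (sym (orbs-formula ok orbs T₀ fo)) (*-comm (2 ^ N) I)
  S/2^N≡I : _/_ S (2 ^ N) ⦃ m^n≢0 2 N ⦄ ≡ I
  S/2^N≡I = trans (cong (λ m → _/_ m (2 ^ N) ⦃ m^n≢0 2 N ⦄) S≡I*2^N) (m*n/n≡m I (2 ^ N) ⦃ m^n≢0 2 N ⦄)
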